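{- If $\mathcal{U}$ is a p-point on $\omega$, then $\prod_{n<\omega}\mathcal{U}\equiv_T\mathcal{U}\times\omega^\omega$, and therefore $\prod_{n<\omega}\mathcal{U}\equiv_T\mathcal{U}\cdot\mathcal{U}\cdot\mathcal{U}$.
   Context: Ultrafilters are ordered by $\supseteq$, $\omega^\omega$ by pointwise $\le$ ($h\le g$ iff $h(n)\le g(n)$ for all $n$), and products by the coordinatewise order; $\prod_{n<\omega}\mathcal{U}$ is the product of $\omega$ copies of $\mathcal{U}$. $D\le_T E$ means there is a map $E\to D$ sending cofinal subsets to cofinal subsets; $D\equiv_T E$ means $D\le_T E$ and $E\le_T D$. For ultrafilters $\mathcal{U},\mathcal{V}$ (on $\omega$, or on a countable set identified with $\omega$ via a bijection), $\mathcal{U}\cdot\mathcal{V}=\{A\subseteq\omega\times\omega:\{i:\{j:(i,j)\in A\}\in\mathcal{V}\}\in\mathcal{U}\}$, and $\mathcal{U}\cdot\mathcal{U}\cdot\mathcal{U}=\mathcal{U}\cdot(\mathcal{U}\cdot\mathcal{U})$. A p-point is a nonprincipal ultrafilter on $\omega$ in which every countable subfamily $\{X_n\}$ has some $X$ in the ultrafilter with $X\setminus X_n$ finite for all $n$. -}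

module Defs where

open import Level using (Level; Lift; lift) renaming (suc to lsuc)
open import Data.Nat using (ℕ; _≤_; _<_)
open import Data.Unit using (⊤)
open import Data.Empty using (⊥)
open import Data.Product using (Σ; Σ-syntax; _×_; _,_; proj₁)
open import Data.Sum using (_⊎_)
open import Relation.Nullary using (¬_)
open import Relation.Binary.PropositionalEquality using (_≡_)

Subset : Set → Set₁
Subset X = X → Set

_⊆_ : {X : Set} → Subset X → Subset X → Set
A ⊆ B = ∀ x → A x → B x

record IsUltrafilter {X : Set} (U : Subset X → Set) : Set₁ where
  field
    contains-full : U (λ _ → ⊤)
    proper        : ¬ U (λ _ → ⊥)
    upward        : ∀ {A B} → A ⊆ B → U A → U B
    meet          : ∀ {A B} → U A → U B → U (λ x → A x × B x)
    ultra         : ∀ A → U A ⊎ U (λ x → ¬ A x)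

NonPrincipal : (Subset ℕ → Set) → Set
NonPrincipal U = ∀ n → ¬ U (λ m → m ≡ n)

Finite : Subset ℕ → Set
Finite A = Σ[ b ∈ ℕ ] (∀ m → A m → m < b)

PProperty : (Subset ℕ → Set) → Set₁
PProperty U = (Xs : ℕ → Subset ℕ) → (∀ n → U (Xs n)) →
  Σ[ X ∈ Subset ℕ ] (U X × (∀ n → Finite (λ m → X m × ¬ Xs n m)))

IsPPoint : (Subset ℕ → Set) → Set₁
IsPPoint U = IsUltrafilter U × NonPrincipal U × PProperty U

_·_ : {X Y : Set} → (Subset X → Set) → (Subset Y → Set) → Subset (X × Y) → Set
(U · V) A = U (λ i → V (λ j → A (i , j)))

-- Ordered sets (only the order relation matters for Tukey reducibility)
record Ord : Set₂ where
  field
    Carrier : Set₁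
    _≼_     : Carrier → Carrier → Set₁

open Ord public

FOrd : {X : Set} → (Subset X → Set) → Ord
FOrd {X} U = record
  { Carrier = Σ[ A ∈ Subset X ] U A
  ; _≼_ = λ a b → Lift _ (proj₁ b ⊆ proj₁ a) }

Baire : Ord
Baire = record
  { Carrier = Lift _ (ℕ → ℕ)
  ; _≼_ = λ { (lift h) (lift g) → Lift _ (∀ n → h n ≤ g n) } }

_⊗_ : Ord → Ord → Ord
D ⊗ E = record
  { Carrier = Carrier D × Carrier E
  ; _≼_ = λ { (d , e) (d' , e') → _≼_ D d d' × _≼_ E e e' } }

Πω : Ord → Ord
Πω D = record
  { Carrier = ℕ → Carrier D
  ; _≼_ = λ f g → ∀ n → _≼_ D (f n) (g n) }

Cofinal : (D : Ord) → (Carrier D → Set₁) → Set₁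
Cofinal D C = ∀ d → Σ[ c ∈ Carrier D ] (C c × _≼_ D d c)

Image : {D E : Ord} → (Carrier E → Carrier D) → (Carrier E → Set₁) → Carrier D → Set₁
Image {D} {E} f C d = Σ[ e ∈ Carrier E ] (C e × f e ≡ d)

_≤T_ : Ord → Ord → Set₂
D ≤T E = Σ[ f ∈ (Carrier E → Carrier D) ]
  ((C : Carrier E → Set₁) → Cofinal E C → Cofinal D (Image {D} {E} f C))

_≡T_ : Ord → Ord → Set₂
D ≡T E = (D ≤T E) × (E ≤T D)

module Submission where

-- Both equivalences are proved through the middle term U × ω^ω.  Every Tukey
-- reduction D ≤T E is built from a pair of maps f : E → D, g : D → E with
-- g d ≼ e ⇒ d ≼ f e (lemma ≤T-intro); ≡T is then composed by transitivity.
--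
--  * U × ω^ω ≤T Πω U : keep the 0-th coordinate, and read a function off the
--    remaining coordinates by picking one element of each set.
--  * Πω U ≤T U × ω^ω : this is where the p-point is used.  A sequence of sets
--    has a pseudo-intersection X ∈ U together with bounds b with X ∩ [b n, ∞) ⊆ Xₙ;
--    conversely a pair (X , b) yields the sequence of sets X ∩ [b n, ∞).
--  * U × ω^ω ≤T U·U·U : A ∈ U·U·U gives its set of good first coordinates and
--    the function n ↦ k for some (i , j , k) ∈ A with j ≥ n; conversely (B , h)
--    gives the set of triples (i , j , k) with i ∈ B and k ≥ max h[0..j].
--  * U·U·U ≤T U × ω^ω : every A ∈ U·U·U contains all "fast triples" from B with
--    growth along h, as soon as B is below a set B₀ and h above a function h₀
--    built from three applications of the p-point property to A.
--
-- Classical logic (excluded middle for Set) is used to pick elements of members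
-- of U and to read off membership from the finiteness of set differences.

open import Defs
open import Data.Nat using (ℕ)
open import Data.Product using (_×_)
open import Axiom.ExcludedMiddle using (ExcludedMiddle)

open import Level using (0ℓ; lift; lower)
open import Data.Nat using (zero; suc; _≤_; _⊔_; z≤n; s≤s)
open import Data.Nat.Properties
  using (≤-refl; ≤-trans; ≤-antisym; ≮⇒≥; <⇒≱; m≤n⇒m<n∨m≡n; m≤m⊔n; m≤n⊔m; m⊔n≤o⇒m≤o; m⊔n≤o⇒n≤o)
open import Data.Product using (Σ; Σ-syntax; _,_; proj₁; proj₂)
open import Data.Sum using (inj₁; inj₂)
open import Data.Empty using (⊥-elim)
open import Relation.Nullary using (yes; no; ¬_)
open import Relation.Binary.PropositionalEquality using (refl; trans; cong)

-- A Tukey reduction from a "convergent" map f with a witness g: to cover d by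
-- the image of a cofinal set, cover g d first and apply f.
≤T-intro : (D E : Ord) (f : Carrier E → Carrier D) (g : Carrier D → Carrier E) →
  (∀ d e → _≼_ E (g d) e → _≼_ D d (f e)) → D ≤T E
≤T-intro D E f g adjoint = f , λ C cofinal d →
  let (e , e∈C , gd≼e) = cofinal (g d)
  in f e , (e , e∈C , refl) , adjoint d e gd≼e

≤T-trans : (D E F : Ord) → D ≤T E → E ≤T F → D ≤T F
≤T-trans D E F (f , f-cofinal) (f' , f'-cofinal) = (λ x → f (f' x)) , λ C cofinal d →
  let (x , (e , (y , y∈C , f'y≡e) , fe≡x) , d≼x) = f-cofinal (Image {E} {F} f' C) (f'-cofinal C cofinal) d
  in x , (y , y∈C , trans (cong f f'y≡e) fe≡x) , d≼x

≡T-trans : (D E F : Ord) → D ≡T E → E ≡T F → D ≡T F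
≡T-trans D E F (D≤E , E≤D) (E≤F , F≤E) = ≤T-trans D E F D≤E E≤F , ≤T-trans F E D F≤E E≤D

runningMax : (ℕ → ℕ) → ℕ → ℕ
runningMax f zero = f zero
runningMax f (suc m) = f (suc m) ⊔ runningMax f m

runningMax-≥ : (f : ℕ → ℕ) {i m : ℕ} → i ≤ m → f i ≤ runningMax f m
runningMax-≥ f {m = zero} z≤n = ≤-refl
runningMax-≥ f {i} {suc m} i≤1+m with m≤n⇒m<n∨m≡n i≤1+m
... | inj₂ refl = m≤m⊔n (f (suc m)) (runningMax f m)
... | inj₁ (s≤s i≤m) = ≤-trans (runningMax-≥ f i≤m) (m≤n⊔m (f (suc m)) (runningMax f m))

runningMax₂ : (ℕ → ℕ → ℕ) → ℕ → ℕ
runningMax₂ b m = runningMax (λ i → runningMax (b i) m) m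

runningMax₂-≥ : (b : ℕ → ℕ → ℕ) (i j : ℕ) → b i j ≤ runningMax₂ b (i ⊔ j)
runningMax₂-≥ b i j =
  ≤-trans (runningMax-≥ (b i) (m≤n⊔m i j))
          (runningMax-≥ (λ i' → runningMax (b i') (i ⊔ j)) (m≤m⊔n i j))

beyondBound : ExcludedMiddle 0ℓ → {X Y : Subset ℕ} (fin : Finite (λ m → X m × ¬ Y m)) →
  ∀ {m} → X m → proj₁ fin ≤ m → Y m
beyondBound em {Y = Y} (b , bounded) {m} Xm b≤m with em {Y m}
... | yes Ym = Ym
... | no ¬Ym = ⊥-elim (<⇒≱ (bounded m (Xm , ¬Ym)) b≤m)

module FilterFacts (em : ExcludedMiddle 0ℓ) {X : Set} {U : Subset X → Set} (isU : IsUltrafilter U) where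
  open IsUltrafilter isU

  witness : ∀ {A} → U A → Σ X A
  witness {A} A∈U with em {Σ X A}
  ... | yes inhabited = inhabited
  ... | no empty = ⊥-elim (proper (upward (λ x Ax → empty (x , Ax)) A∈U))

  conditional : {P : Set} {A : Subset X} → (P → U A) → U (λ x → P → A x)
  conditional {P} forces with em {P}
  ... | yes p = upward (λ x Ax _ → Ax) (forces p)
  ... | no ¬p = upward (λ x _ p → ⊥-elim (¬p p)) contains-full

tails : {U : Subset ℕ → Set} → IsUltrafilter U → NonPrincipal U → ∀ n → U (n ≤_)
tails isU nonprincipal zero = IsUltrafilter.upward isU (λ _ _ → z≤n) (IsUltrafilter.contains-full isU)
tails isU nonprincipal (suc n) with IsUltrafilter.ultra isU (suc n ≤_)
... | inj₁ above = above
... | inj₂ notAbove = ⊥-elim (nonprincipal n (upward (λ m (n≤m , m≯n) → ≤-antisym (≮⇒≥ m≯n) n≤m)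
                                                     (meet (tails isU nonprincipal n) notAbove)))
  where open IsUltrafilter isU

record PseudoIntersection (U : Subset ℕ → Set) (Xs : ℕ → Subset ℕ) : Set₁ where
  field
    base       : Subset ℕ
    base∈U     : U base
    bound      : ℕ → ℕ
    eventually : ∀ n {m} → base m → bound n ≤ m → Xs n m

pseudoIntersection : ExcludedMiddle 0ℓ → {U : Subset ℕ → Set} → PProperty U →
  {Xs : ℕ → Subset ℕ} → (∀ n → U (Xs n)) → PseudoIntersection U Xs
pseudoIntersection em pproperty Xs∈U =
  let (X , X∈U , almost) = pproperty _ Xs∈U
  in record { base = X ; base∈U = X∈U ; bound = λ n → proj₁ (almost n)
            ; eventually = λ n → beyondBound em (almost n) }

module PPoint (em : ExcludedMiddle 0ℓ) (U : Subset ℕ → Set) (pt : IsPPoint U) where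
  private
    isU : IsUltrafilter U
    isU = proj₁ pt
  open IsUltrafilter isU
  open FilterFacts em isU

  tail : ∀ n → U (n ≤_)
  tail = tails isU (proj₁ (proj₂ pt))

  pseudo : {Xs : ℕ → Subset ℕ} → (∀ n → U (Xs n)) → PseudoIntersection U Xs
  pseudo = pseudoIntersection em (proj₂ (proj₂ pt))

  UBaire : Ord
  UBaire = FOrd U ⊗ Baire

  UUU : Ord
  UUU = FOrd (U · (U · U))

  UBaire≤Πω : UBaire ≤T Πω (FOrd U)
  UBaire≤Πω = ≤T-intro UBaire (Πω (FOrd U)) f g adjoint
    where
    f : Carrier (Πω (FOrd U)) → Carrier UBaire
    f Xs = Xs zero , lift (λ k → proj₁ (witness (proj₂ (Xs (suc k)))))
    g : Carrier UBaire → Carrier (Πω (FOrd U))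
    g (A , _) zero = A
    g (_ , lift h) (suc k) = (h k ≤_) , tail (h k)
    adjoint : ∀ d e → _≼_ (Πω (FOrd U)) (g d) e → _≼_ UBaire d (f e)
    adjoint (A , lift h) Xs gd≼Xs = gd≼Xs zero ,
      lift (λ k → lower (gd≼Xs (suc k)) _ (proj₂ (witness (proj₂ (Xs (suc k))))))

  Πω≤UBaire : Πω (FOrd U) ≤T UBaire
  Πω≤UBaire = ≤T-intro (Πω (FOrd U)) UBaire f g adjoint
    where
    g : Carrier (Πω (FOrd U)) → Carrier UBaire
    g Xs = (base , base∈U) , lift bound
      where open PseudoIntersection (pseudo (λ n → proj₂ (Xs n)))
    f : Carrier UBaire → Carrier (Πω (FOrd U))
    f ((A , A∈U) , lift h) n = (λ m → A m × h n ≤ m) , meet A∈U (tail (h n))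
    adjoint : ∀ d e → _≼_ UBaire (g d) e → _≼_ (Πω (FOrd U)) d (f e)
    adjoint Xs ((A , A∈U) , lift h) (lift A⊆base , lift bound≤h) n =
      lift (λ m (Am , hn≤m) → eventually n (A⊆base m Am) (≤-trans (bound≤h n) hn≤m))
      where open PseudoIntersection (pseudo (λ n → proj₂ (Xs n)))

  tripleWithLarge : ∀ {A} → (U · (U · U)) A → ∀ n → Σ[ i ∈ ℕ ] Σ[ j ∈ ℕ ] Σ[ k ∈ ℕ ] (n ≤ j × A (i , j , k))
  tripleWithLarge A∈W n =
    let (i , Ai∈UU) = witness (upward (λ i Ai∈UU → meet Ai∈UU (tail n)) A∈W)
        (j , Aij∈U , n≤j) = witness Ai∈UU
        (k , Aijk) = witness Aij∈U
    in i , j , k , n≤j , Aijk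

  UBaire≤UUU : UBaire ≤T UUU
  UBaire≤UUU = ≤T-intro UBaire UUU f g adjoint
    where
    g : Carrier UBaire → Carrier UUU
    g ((B , B∈U) , lift h) = (λ (i , j , k) → B i × runningMax h j ≤ k) ,
      upward (λ i Bi → upward (λ j _ → upward (λ k above → Bi , above) (tail (runningMax h j))) contains-full) B∈U
    f : Carrier UUU → Carrier UBaire
    f (A , A∈W) = ((λ i → U (λ j → U (λ k → A (i , j , k)))) , A∈W) ,
      lift (λ n → let (_ , _ , k , _) = tripleWithLarge A∈W n in k)
    adjoint : ∀ d e → _≼_ UUU (g d) e → _≼_ UBaire d (f e)
    adjoint ((B , _) , lift h) (A , A∈W) (lift A⊆gd) =
      lift (λ i Ai∈UU → let (j , Aij∈U) = witness Ai∈UU ; (k , Aijk) = witness Aij∈U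
                        in proj₁ (A⊆gd (i , j , k) Aijk)) ,
      lift (λ n → let (i , j , k , n≤j , Aijk) = tripleWithLarge A∈W n
                  in ≤-trans (runningMax-≥ h n≤j) (proj₂ (A⊆gd (i , j , k) Aijk)))

  fastTriples : Subset ℕ → (ℕ → ℕ) → Subset (ℕ × ℕ × ℕ)
  fastTriples B h (i , j , k) = B i × B j × h i ≤ j × B k × h i ≤ k × h (i ⊔ j) ≤ k

  -- Fast triples of a member of U form a member of U·U·U, since tails are in U.
  fastTriples∈UUU : ∀ {B} h → U B → (U · (U · U)) (fastTriples B h)
  fastTriples∈UUU {B} h B∈U =
    upward (λ i Bi → upward (λ j (Bj , hi≤j) →
                       upward (λ k (Bk , hi≤k , hij≤k) → Bi , Bj , hi≤j , Bk , hi≤k , hij≤k)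
                              (meet B∈U (meet (tail (h i)) (tail (h (i ⊔ j))))))
                     (meet B∈U (tail (h i)))) B∈U

  module Approximation (A : Subset (ℕ × ℕ × ℕ)) (A∈W : (U · (U · U)) A) where
    Good : Subset ℕ
    Good i = U (λ j → U (λ k → A (i , j , k)))

    -- for good i, almost all fibres Aᵢⱼ are in U
    First : PseudoIntersection U (λ i j → Good i → U (λ k → A (i , j , k)))
    First = pseudo (λ i → conditional {Good i} (λ Ai∈UU → Ai∈UU))
    -- for each i, j with Aᵢⱼ ∈ U, almost every k gives a triple in A
    Second : ∀ i → PseudoIntersection U (λ j k → U (λ k' → A (i , j , k')) → A (i , j , k))
    Second i = pseudo (λ j → conditional (λ Aij∈U → Aij∈U))
    Third : PseudoIntersection U (λ i → PseudoIntersection.base (Second i))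
    Third = pseudo (λ i → PseudoIntersection.base∈U (Second i))
    open PseudoIntersection First renaming (base to X₁; base∈U to X₁∈U; bound to b₁; eventually to ev₁)
    open PseudoIntersection Third renaming (base to X₃; base∈U to X₃∈U; bound to c; eventually to ev₃)
    open module SecondAt i = PseudoIntersection (Second i) renaming (base to X₂; bound to b₂; eventually to ev₂)

    B₀ : Subset ℕ
    B₀ i = Good i × X₁ i × X₃ i

    B₀∈U : U B₀
    B₀∈U = meet A∈W (meet X₁∈U X₃∈U)

    h₀ : ℕ → ℕ
    h₀ m = b₁ m ⊔ c m ⊔ runningMax₂ b₂ m

    approximates : ∀ {B h} → B ⊆ B₀ → (∀ n → h₀ n ≤ h n) → fastTriples B h ⊆ A
    approximates {B} {h} B⊆B₀ h₀≤h (i , j , k) (Bi , Bj , hi≤j , Bk , hi≤k , hij≤k) =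
      ev₂ i j k∈X₂ b₂≤k Aij∈U
      where
      b₁≤h : ∀ n → b₁ n ≤ h n
      b₁≤h n = m⊔n≤o⇒m≤o (b₁ n) (c n) (m⊔n≤o⇒m≤o _ _ (h₀≤h n))
      c≤h : ∀ n → c n ≤ h n
      c≤h n = m⊔n≤o⇒n≤o (b₁ n) (c n) (m⊔n≤o⇒m≤o _ _ (h₀≤h n))
      Aij∈U : U (λ k → A (i , j , k))
      Aij∈U = ev₁ i (proj₁ (proj₂ (B⊆B₀ j Bj))) (≤-trans (b₁≤h i) hi≤j) (proj₁ (B⊆B₀ i Bi))
      k∈X₂ : X₂ i k
      k∈X₂ = ev₃ i (proj₂ (proj₂ (B⊆B₀ k Bk))) (≤-trans (c≤h i) hi≤k)
      b₂≤k : b₂ i j ≤ k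
      b₂≤k = ≤-trans (runningMax₂-≥ b₂ i j) (≤-trans (m⊔n≤o⇒n≤o _ _ (h₀≤h (i ⊔ j))) hij≤k)

  UUU≤UBaire : UUU ≤T UBaire
  UUU≤UBaire = ≤T-intro UUU UBaire f g adjoint
    where
    f : Carrier UBaire → Carrier UUU
    f ((B , B∈U) , lift h) = fastTriples B h , fastTriples∈UUU h B∈U
    g : Carrier UUU → Carrier UBaire
    g (A , A∈W) = (B₀ , B₀∈U) , lift h₀
      where open Approximation A A∈W
    adjoint : ∀ d e → _≼_ UBaire (g d) e → _≼_ UUU d (f e)
    adjoint (A , A∈W) _ (lift B⊆B₀ , lift h₀≤h) = lift (approximates B⊆B₀ h₀≤h)
      where open Approximation A A∈W

theorem33 : (em : ∀ {ℓ} → ExcludedMiddle ℓ) → (U : Subset ℕ → Set) → IsPPoint U →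
    (Πω (FOrd U) ≡T (FOrd U ⊗ Baire)) × (Πω (FOrd U) ≡T FOrd (U · (U · U)))
theorem33 em U pt = Πω≡UBaire , ≡T-trans (Πω (FOrd U)) UBaire UUU Πω≡UBaire UBaire≡UUU
  where
  open PPoint em U pt
  Πω≡UBaire : Πω (FOrd U) ≡T UBaire
  Πω≡UBaire = Πω≤UBaire , UBaire≤Πω
  UBaire≡UUU : UBaire ≡T UUU
  UBaire≡UUU = UBaire≤UUU , UUU≤UBaire
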